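{- Let $\mathcal{F}$ be a union-closed family of finite sets with $\emptyset\in\mathcal{F}$, let $U\subseteq\bigcup\mathcal{F}$, and let $\mathcal{F}'$ be an extension of $(\mathcal{F},U)$. Let $X\in\mathcal{F}'_{\setminus U}$ and let $Y\subseteq U$ satisfy (i) $\pi_{\mathcal{F}}(X\cup Y)\cap U=Y$, and (ii) $\pi_{\mathcal{F}}(X\cup Y)\supseteq\pi_{\mathcal{F}}(X\cup U)\setminus U$. Then $X\cup Y\in\mathcal{F}'$.
   Context: $\pi_{\mathcal{F}}(X)=\bigcup\{V\in\mathcal{F}:V\subseteq X\}$. For families $\mathcal{A},\mathcal{B}$, $\mathcal{A}\vee\mathcal{B}=\{A\cup B:A\in\mathcal{A},B\in\mathcal{B}\}$ and $\mathcal{A}_{\setminus Z}=\{A\setminus Z:A\in\mathcal{A}\}$. A union-closed family $\mathcal{F}'$ is an extension of $(\mathcal{F},U)$ if $\mathcal{F}'=\mathcal{F}\vee\mathcal{H}$ for some nonempty union-closed family $\mathcal{H}$ with $(\bigcup\mathcal{H})\cap U=\emptyset$. -}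

module Defs where

open import Data.Nat using (ℕ)
open import Data.Fin using (Fin)
open import Data.Fin.Subset public
  using (Subset; _∈_; _∉_; _⊆_; _∪_; _∩_; _─_; ⊥)
open import Data.Product using (Σ; ∃; _×_)
open import Relation.Binary.PropositionalEquality using (_≡_)
open import Relation.Nullary using (¬_)

Family : ℕ → Set₁
Family n = Subset n → Set

module _ {n : ℕ} where

  UnionClosed : Family n → Set
  UnionClosed 𝓕 = ∀ A B → 𝓕 A → 𝓕 B → 𝓕 (A ∪ B)

  _∈⋃_ : Fin n → Family n → Set
  x ∈⋃ 𝓕 = ∃ λ A → 𝓕 A × x ∈ A

  -- x ∈ π_𝓕(X) = ⋃ { V ∈ 𝓕 : V ⊆ X }
  _∈π[_]_ : Fin n → Family n → Subset n → Set
  x ∈π[ 𝓕 ] X = ∃ λ V → 𝓕 V × V ⊆ X × x ∈ V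

  _∨_ : Family n → Family n → Family n
  (𝓐 ∨ 𝓑) Z = ∃ λ A → ∃ λ B → 𝓐 A × 𝓑 B × Z ≡ A ∪ B

  _∖ᶠ_ : Family n → Subset n → Family n
  (𝓐 ∖ᶠ Z) W = ∃ λ A → 𝓐 A × W ≡ A ─ Z

  IsExtension : Family n → Family n → Subset n → Set₁
  IsExtension 𝓕' 𝓕 U =
    UnionClosed 𝓕' ×
    Σ (Family n) λ 𝓗 →
      UnionClosed 𝓗 × (∃ λ B → 𝓗 B) × (∀ x → x ∈⋃ 𝓗 → x ∉ U) ×
      (∀ Z → (𝓕' Z → (𝓕 ∨ 𝓗) Z) × ((𝓕 ∨ 𝓗) Z → 𝓕' Z))

module Submission where

open import Defs
open import Data.Nat using (ℕ)
open import Data.Fin using (Fin)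
open import Data.Fin.Subset using (inside; outside)
open import Data.Fin.Subset.Properties
  using (_∈?_; ⊥⊆; ⊆-antisym; x∈p∪q⁻; x∈p∪q⁺; p⊆p∪q; q⊆p∪q; p─q⊆p; x∈p∧x∉q⇒x∈p─q)
open import Data.List using (List; []; _∷_; allFin)
open import Data.List.Relation.Unary.Any using (here; there)
import Data.List.Membership.Propositional as List
open import Data.List.Membership.Propositional.Properties using (∈-allFin)
open import Data.Vec using (_∷_; here; there)
open import Data.Product using (_×_; _,_; ∃; proj₁; proj₂)
open import Data.Sum using (inj₁; inj₂; [_,_])
open import Relation.Nullary using (yes; no; contradiction)
open import Relation.Binary.PropositionalEquality using (_≡_; refl)

-- Write X = (A ∪ H) ∖ U with A ∈ 𝓕, H ∈ 𝓗 and H disjoint from U, and let B be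
-- the largest member of 𝓕 inside X ∪ Y (it exists: 𝓕 is finite, union-closed
-- and contains ∅). Then X ∪ Y = B ∪ H ∈ 𝓕 ∨ 𝓗 = 𝓕': hypothesis (i) puts Y
-- into B, and since A ⊆ X ∪ U, hypothesis (ii) puts A ∖ U into B.

x∈p─q⇒x∉q : ∀ {n} {x : Fin n} (p q : Subset n) → x ∈ p ─ q → x ∉ q
x∈p─q⇒x∉q (inside ∷ p) (outside ∷ q) here = λ ()
x∈p─q⇒x∉q (_ ∷ p) (_ ∷ q) (there x∈p─q) (there x∈q) = x∈p─q⇒x∉q p q x∈p─q x∈q

p⊆[p∪r]─q∪q : ∀ {n} (p r q : Subset n) → p ⊆ ((p ∪ r) ─ q) ∪ q
p⊆[p∪r]─q∪q p r q {x} x∈p with x ∈? q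
... | yes x∈q = x∈p∪q⁺ (inj₂ x∈q)
... | no x∉q = x∈p∪q⁺ (inj₁ (x∈p∧x∉q⇒x∈p─q (p⊆p∪q r x∈p) x∉q))

[p∪r]─q∪s≡t∪r : ∀ {n} {p r q s t : Subset n} → (∀ x → x ∈ r → x ∉ q) →
                t ⊆ ((p ∪ r) ─ q) ∪ s → s ∪ (p ─ q) ⊆ t →
                ((p ∪ r) ─ q) ∪ s ≡ t ∪ r
[p∪r]─q∪s≡t∪r {p = p} {r} {q} {s} {t} r∩q≡∅ t⊆ s∪[p─q]⊆t = ⊆-antisym ⊆t∪r t∪r⊆
  where
  ⊆t∪r : ((p ∪ r) ─ q) ∪ s ⊆ t ∪ r
  ⊆t∪r x∈ with x∈p∪q⁻ ((p ∪ r) ─ q) s x∈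
  ... | inj₂ x∈s = x∈p∪q⁺ (inj₁ (s∪[p─q]⊆t (x∈p∪q⁺ (inj₁ x∈s))))
  ... | inj₁ x∈[p∪r]─q with x∈p∪q⁻ p r (p─q⊆p (p ∪ r) q x∈[p∪r]─q)
  ...   | inj₁ x∈p = x∈p∪q⁺ (inj₁ (s∪[p─q]⊆t (x∈p∪q⁺ (inj₂
                       (x∈p∧x∉q⇒x∈p─q x∈p (x∈p─q⇒x∉q (p ∪ r) q x∈[p∪r]─q))))))
  ...   | inj₂ x∈r = x∈p∪q⁺ (inj₂ x∈r)

  t∪r⊆ : t ∪ r ⊆ ((p ∪ r) ─ q) ∪ s
  t∪r⊆ {x} x∈ = [ t⊆ , (λ x∈r → x∈p∪q⁺ (inj₁ (x∈p∧x∉q⇒x∈p─q (q⊆p∪q p r x∈r) (r∩q≡∅ x x∈r)))) ]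
                (x∈p∪q⁻ t r x∈)

module _ {n : ℕ} {𝓕 : Family n} (∪-closed : UnionClosed 𝓕) (⊥∈𝓕 : 𝓕 ⊥) {S T : Subset n}
         (T⊆πS : ∀ x → x ∈ T → x ∈π[ 𝓕 ] S) where

  member-covering : (xs : List (Fin n)) →
                    ∃ λ B → 𝓕 B × B ⊆ S × (∀ {x} → x List.∈ xs → x ∈ T → x ∈ B)
  member-covering [] = ⊥ , ⊥∈𝓕 , ⊥⊆ , λ ()
  member-covering (x ∷ xs) with member-covering xs | x ∈? T
  ... | B , B∈𝓕 , B⊆S , covers | no x∉T =
    B , B∈𝓕 , B⊆S , λ { (here refl) x∈T → contradiction x∈T x∉T ; (there y∈xs) → covers y∈xs }
  ... | B , B∈𝓕 , B⊆S , covers | yes x∈T with T⊆πS x x∈T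
  ...   | V , V∈𝓕 , V⊆S , x∈V =
    V ∪ B , ∪-closed V B V∈𝓕 B∈𝓕 ,
    (λ y∈ → [ V⊆S , B⊆S ] (x∈p∪q⁻ V B y∈)) ,
    λ { (here refl) _ → x∈p∪q⁺ (inj₁ x∈V) ; (there y∈xs) y∈T → x∈p∪q⁺ (inj₂ (covers y∈xs y∈T)) }

  ⊆π⇒member-between : ∃ λ B → 𝓕 B × B ⊆ S × T ⊆ B
  ⊆π⇒member-between with member-covering (allFin n)
  ... | B , B∈𝓕 , B⊆S , covers = B , B∈𝓕 , B⊆S , λ {x} → covers (∈-allFin x)

lemma3p7 : (n : ℕ) (𝓕 𝓕' : Family n) (U X Y : Subset n)
    → UnionClosed 𝓕 → 𝓕 ⊥
    → (∀ x → x ∈ U → x ∈⋃ 𝓕)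
    → IsExtension 𝓕' 𝓕 U
    → (𝓕' ∖ᶠ U) X
    → Y ⊆ U
    → (∀ x → (x ∈π[ 𝓕 ] (X ∪ Y) × x ∈ U → x ∈ Y) × (x ∈ Y → x ∈π[ 𝓕 ] (X ∪ Y) × x ∈ U))
    → (∀ x → x ∈π[ 𝓕 ] (X ∪ U) → x ∉ U → x ∈π[ 𝓕 ] (X ∪ Y))
    → 𝓕' (X ∪ Y)
lemma3p7 _ 𝓕 _ U _ Y ∪-closed ⊥∈𝓕 _ (_ , _ , _ , _ , ⋃𝓗∩U≡∅ , 𝓕'≡𝓕∨𝓗)
         (C , C∈𝓕' , refl) _ Y≡π[X∪Y]∩U π[X∪U]─U⊆π[X∪Y]
  with proj₁ (𝓕'≡𝓕∨𝓗 C) C∈𝓕'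
... | A , H , A∈𝓕 , H∈𝓗 , refl =
  let B , B∈𝓕 , B⊆X∪Y , Y∪[A─U]⊆B = ⊆π⇒member-between ∪-closed ⊥∈𝓕 Y∪[A─U]⊆π[X∪Y]
  in proj₂ (𝓕'≡𝓕∨𝓗 _) (B , H , B∈𝓕 , H∈𝓗 , [p∪r]─q∪s≡t∪r H∩U≡∅ B⊆X∪Y Y∪[A─U]⊆B)
  where
  H∩U≡∅ : ∀ x → x ∈ H → x ∉ U
  H∩U≡∅ x x∈H = ⋃𝓗∩U≡∅ x (H , H∈𝓗 , x∈H)

  Y∪[A─U]⊆π[X∪Y] : ∀ x → x ∈ Y ∪ (A ─ U) → x ∈π[ 𝓕 ] (((A ∪ H) ─ U) ∪ Y)
  Y∪[A─U]⊆π[X∪Y] x x∈ with x∈p∪q⁻ Y (A ─ U) x∈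
  ... | inj₁ x∈Y = proj₁ (proj₂ (Y≡π[X∪Y]∩U x) x∈Y)
  ... | inj₂ x∈A─U = π[X∪U]─U⊆π[X∪Y] x (A , A∈𝓕 , p⊆[p∪r]─q∪q A H U , p─q⊆p A U x∈A─U)
                                        (x∈p─q⇒x∉q A U x∈A─U)
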